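{- Let $n\ge3$ and let $(C_n,\sigma)$ be any signed graph whose underlying graph is the cycle $C_n$ on $n$ vertices. For $k\ge1$ let $m_k$ denote the number of edges (loops included) of $K_k^*$, and let $k_0$ be the largest integer $k$ such that $n\ge m_k$. Then: (i) if $n\ge m_{k_0}+2$, or $n=m_{k_0}+1$ and $K_{k_0}^*$ and $(C_n,\sigma)$ have different balance, or $n=m_{k_0}$ and $K_{k_0}^*$ and $(C_n,\sigma)$ have the same balance, then $\psi(C_n,\sigma)=k_0$; (ii) if $n=m_{k_0}+1$ and $K_{k_0}^*$ and $(C_n,\sigma)$ have the same balance, or $n=m_{k_0}$, $k_0$ is odd, and $K_{k_0}^*$ and $(C_n,\sigma)$ have different balance, then $\psi(C_n,\sigma)=k_0-1$; (iii) otherwise, $\psi(C_n,\sigma)=k_0-2$.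
   Context: A signed graph $(G,\sigma)$ is a finite simple graph $G$ with a signature $\sigma:E(G)\to\{ -,+\}$. Switching a set $S\subseteq V(G)$ changes the sign of every edge with exactly one end in $S$; two signed graphs on the same underlying graph are equivalent if one is obtained from the other by switching some set of vertices. The balance of a signed (multi)graph is the parity (even or odd) of its number of negative edges, negative loops included. For $k\ge1$ let $M_k=\{ -n,\dots,-1,+1,\dots,+n\}$ if $k=2n$, and $M_k=\{ -n,\dots,-1,\pm0,+1,\dots,+n\}$ if $k=2n+1$, where $\pm0$ is a single colour with $-(\pm0)=\pm0$. A $k$-colouring of $(G,\sigma)$ is a map $\phi:V(G)\to M_k$. Let $K_k^*$ be the signed multigraph with vertex set $\{i\ge 0: +i\in M_k\}$ (vertex $0$ standing for colour $\pm0$ when $k$ is odd), in which every two distinct vertices are joined by exactly one positive and one negative edge, and every vertex $i\neq0$ carries exactly one negative loop (so $K_{2p}^*$ has $p^2$ edges and $K_{2p+1}^*$ has $(p+1)^2-1$ edges). Given a $k$-colouring $\phi$, the reduced signed graph $R(G,\sigma,\phi)$ is obtained by (1) switching every vertex with a negative colour $-i$ and recolouring it $+i$; (2) identifying, for each $i$, all vertices of colour $+i$ (resp. $\pm0$) into a single vertex $i$ (resp. $0$), edges inside a class becoming loops; (3) keeping at most one positive and at most one negative edge (or loop) between any two vertices (or at any vertex). The colouring $\phi$ is complete if $R(G,\sigma,\phi)$ is exactly $K_k^*$. The achromatic number $\psi(G,\sigma)$ is the largest $k\ge1$ such that some signed graph equivalent to $(G,\sigma)$ admits a complete $k$-colouring.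 -}

module Defs where

open import Data.Nat using (ℕ; zero; suc; _+_; _*_; _∸_; _≤_; _<_; NonZero)
open import Data.Nat.DivMod using (_/_; _%_; m%n<n)
open import Data.Nat.Combinatorics using (_C_)
open import Data.Integer using (ℤ; +_; -[1+_]; ∣_∣)
open import Data.Fin using (Fin; zero; suc; toℕ; fromℕ<)
open import Data.Bool using (Bool; true; false; _xor_)
open import Data.Product using (Σ; ∃; ∃-syntax; _×_; _,_; proj₁; proj₂)
open import Data.Sum using (_⊎_)
open import Relation.Binary.PropositionalEquality using (_≡_; _≢_)
open import Relation.Nullary using (¬_)

data Sign : Set where
  pos neg : Sign

_·_ : Sign → Sign → Sign
pos · s = s
neg · pos = neg
neg · neg = pos

flipIf : Bool → Sign → Sign
flipIf false s = s
flipIf true  s = neg · s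

record Graph : Set where
  field
    V    : ℕ
    E    : ℕ
    ends : Fin E → Fin V × Fin V
open Graph public

Signature : Graph → Set
Signature G = Fin (E G) → Sign

switch : (G : Graph) → (Fin (V G) → Bool) → Signature G → Signature G
switch G S σ e = flipIf (S (proj₁ (ends G e)) xor S (proj₂ (ends G e))) (σ e)

-- The cycle C_n : vertices 0..n-1, edge i joins i and i+1 (mod n).

next : ∀ {n} → Fin n → Fin n
next {suc m} i = fromℕ< (m%n<n (suc (toℕ i)) (suc m))

Cycle : ℕ → Graph
Cycle n = record { V = n ; E = n ; ends = λ i → (i , next i) }

-- M_k is represented as a subset of ℤ: colour +i is + i,
-- colour -i is -[1+ (i-1) ], and ±0 is + 0 (so -(±0) = ±0).
-- Vertex set of K_k^* : { a : ℕ | +a ∈ M_k }, i.e. a ≤ ⌊k/2⌋,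
-- and a ≠ 0 when k is even.

KVert : ℕ → ℕ → Set
KVert k a = (a ≤ k / 2) × (k % 2 ≡ 0 → a ≢ 0)

InM : ℕ → ℤ → Set
InM k c = KVert k ∣ c ∣

isNeg : ℤ → Bool
isNeg (+ _)    = false
isNeg -[1+ _ ] = true

-- Reduced signed graph R(G,σ,φ): after switching all negatively
-- coloured vertices, the edge e = uv becomes an edge between the
-- classes ∣φ u∣ and ∣φ v∣ with the following sign.

redSign : (G : Graph) → Signature G → (Fin (V G) → ℤ) → Fin (E G) → Sign
redSign G σ φ e =
  flipIf (isNeg (φ (proj₁ (ends G e))) xor isNeg (φ (proj₂ (ends G e)))) (σ e)

redEnd₁ redEnd₂ : (G : Graph) → (Fin (V G) → ℤ) → Fin (E G) → ℕ
redEnd₁ G φ e = ∣ φ (proj₁ (ends G e)) ∣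
redEnd₂ G φ e = ∣ φ (proj₂ (ends G e)) ∣

Complete : (G : Graph) → Signature G → ℕ → (Fin (V G) → ℤ) → Set
Complete G σ k φ =
  (∀ v → InM k (φ v))
  × (∀ a → KVert k a → ∃[ v ] ∣ φ v ∣ ≡ a)
  × (∀ e → redEnd₁ G φ e ≡ redEnd₂ G φ e →
       (redEnd₁ G φ e ≢ 0) × (redSign G σ φ e ≡ neg))
  × (∀ a b → KVert k a → KVert k b → a ≢ b → ∀ s →
       ∃[ e ] (((redEnd₁ G φ e ≡ a × redEnd₂ G φ e ≡ b)
               ⊎ (redEnd₁ G φ e ≡ b × redEnd₂ G φ e ≡ a))
              × redSign G σ φ e ≡ s))
  × (∀ a → KVert k a → a ≢ 0 →
       ∃[ e ] (redEnd₁ G φ e ≡ a × redEnd₂ G φ e ≡ a × redSign G σ φ e ≡ neg))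

HasCompleteColouring : (G : Graph) → Signature G → ℕ → Set
HasCompleteColouring G σ k =
  ∃[ S ] ∃[ φ ] Complete G (switch G S σ) k φ

AchromaticNumberIs : (G : Graph) → Signature G → ℕ → Set
AchromaticNumberIs G σ k =
  (1 ≤ k) × HasCompleteColouring G σ k
  × (∀ j → k < j → ¬ HasCompleteColouring G σ j)

kVerts : ℕ → ℕ
kVerts k = k / 2 + k % 2

-- m_k : number of edges (loops included) of K_k^*:
-- two edges per pair of distinct vertices, plus one loop per vertex ≠ 0
-- (equals p² for k = 2p and (p+1)² - 1 for k = 2p+1)
edgesK : ℕ → ℕ
edgesK k = 2 * (kVerts k C 2) + k / 2

negEdgesK : ℕ → ℕ
negEdgesK k = kVerts k C 2 + k / 2

negCount : (n : ℕ) → (Fin n → Sign) → ℕ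
negCount zero    σ = 0
negCount (suc n) σ with σ zero
... | pos = negCount n (λ i → σ (suc i))
... | neg = suc (negCount n (λ i → σ (suc i)))

-- balance = parity of the number of negative edges
SameBalance : ℕ → ℕ → Set
SameBalance x y = x % 2 ≡ y % 2

IsK0 : ℕ → ℕ → Set
IsK0 n k = (1 ≤ k) × (edgesK k ≤ n) × (∀ j → 1 ≤ j → edgesK j ≤ n → j ≤ k)

-- A complete k-colouring of a signed cycle C_n amounts to a closed walk of length n in K_k^*
-- that uses every edge of K_k^*, together with a switching of σ matching its signs; on a cycle
-- that switching exists exactly when the numbers of negative edges have the same parity.
-- K_k^* (k ≥ 2) has an Euler tour through vertex 1, which carries a negative loop.  Padding the
-- tour with negative loops at 1, or with a positive and a negative edge from 1 to another
-- vertex, gives complete colourings for n = m_k + d with either balance when d ≥ 2 (and k ≥ 3),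
-- and with one prescribed balance when d ∈ {0, 1}.  Conversely the reduced edges of a complete
-- colouring contain every edge of K_k^*, so m_k ≤ n; if n = m_k they are exactly the edges of
-- K_k^* and the balances agree; if n = m_k + 1 the one extra edge has even degree at every vertex,
-- since both C_n and the tour are closed walks, so it is a loop, hence negative, and the balances
-- differ.  The three cases follow because m_{k+1} - m_k is k for even k and 1 for odd k.

module Submission where

open import Defs
open import Algebra.Bundles using (CommutativeRing; CommutativeMonoid)
open import Data.Bool using (Bool; true; false; not; _xor_; if_then_else_; T)
open import Data.Bool.Properties
  using (not-involutive; not-¬; ¬-not; xor-assoc; xor-comm; xor-identityʳ; xor-same; xor-∧-commutativeRing)
open import Data.Empty using (⊥-elim)
open import Data.Integer using (ℤ; ∣_∣)
import Data.Integer as ℤ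
open import Data.List using (List; []; _∷_; [_]; _++_; length; lookup; replicate)
open import Data.List.Properties using (length-++; length-replicate)
open import Data.List.Membership.Propositional.Properties using (∈-lookup)
open import Data.List.Relation.Unary.All as All using (All; []; _∷_)
import Data.List.Relation.Unary.All.Properties as AllP
open import Data.List.Relation.Unary.AllPairs using (AllPairs; []; _∷_)
import Data.List.Relation.Unary.AllPairs.Properties as APP
open import Data.List.Relation.Unary.Any using (Any; index; here; there)
open import Data.List.Relation.Unary.Any.Properties as AnyP using (lookup-index)
open import Data.Fin using (Fin; zero; suc; toℕ; fromℕ; inject₁; punchOut)
open import Data.Fin.Properties
  using ( toℕ-fromℕ<; toℕ-inject₁; toℕ-fromℕ; toℕ-injective; toℕ<n; suc-injective
        ; injective⇒≤; punchOut-injective; any?)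
  renaming (_≟_ to _≟ᶠ_)
open import Data.Fin.Permutation using (Permutation; permutation)
open import Data.Nat using (ℕ; zero; suc; _+_; _*_; _∸_; _≤_; _<_; _%_; _/_; _≡ᵇ_; _≟_; s≤s; z≤n; z<s)
open import Data.Nat.Combinatorics using (_C_; nCk+nC[k+1]≡[n+1]C[k+1]; nC1≡n)
open import Data.Nat.Tactic.RingSolver using (solve-∀)
open import Data.Nat.DivMod using (n%n≡0; m<n⇒m%n≡m; m*n/n≡m; m*n%n≡0; +-distrib-/; [m+kn]%n≡m%n; m≥n⇒m/n>0)
open import Data.Nat.Properties
  using ( <-irrefl; <-cmp; <⇒≱; <⇒≢; <⇒≤; 1+n≰n; ≡ᵇ⇒≡; ≤-antisym; ≤-trans; ≤-refl; ≤-reflexive; ≤-pred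
        ; m≤n⇒m<n∨m≡n; m≤n⇒∃[o]m+o≡n; m<m+n; m≤m+n; m<n⇒m<1+n; n<1+n; n≤1+n
        ; +-monoʳ-≤; +-suc; +-identityʳ; +-comm; +-assoc)
import Data.Product as Product
open import Data.Product using (∃-syntax; _×_; _,_; proj₁; proj₂)
import Data.Sum as Sum
open import Data.Sum using (_⊎_; inj₁; inj₂)
open import Function.Base using (_∘_)
open import Function.Definitions using (Injective)
open import Relation.Binary.PropositionalEquality hiding ([_])
open import Relation.Nullary using (¬_; yes; no)
open import Relation.Nullary.Decidable using (¬?)
open import Relation.Binary.Definitions using (tri<; tri≈; tri>)

parity : ℕ → Bool
parity zero    = false
parity (suc n) = not (parity n)

%2≡parity : ∀ n → n % 2 ≡ (if parity n then 1 else 0)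
%2≡parity zero          = refl
%2≡parity (suc zero)    = refl
%2≡parity (suc (suc n)) =
  trans (%2≡parity n) (cong (λ b → if b then 1 else 0) (sym (not-involutive (parity n))))

sameBalance⇒parity≡ : ∀ {m n} → SameBalance m n → parity m ≡ parity n
sameBalance⇒parity≡ {m} {n} eq = bit-injective (trans (sym (%2≡parity m)) (trans eq (%2≡parity n)))
  where
  bit-injective : ∀ {a b} → (if a then 1 else 0) ≡ (if b then 1 else 0) → a ≡ b
  bit-injective {false} {false} _ = refl
  bit-injective {true}  {true}  _ = refl
  bit-injective {false} {true}  ()
  bit-injective {true}  {false} ()

parity≡⇒sameBalance : ∀ {m n} → parity m ≡ parity n → SameBalance m n
parity≡⇒sameBalance {m} {n} eq =
  trans (%2≡parity m) (trans (cong (λ b → if b then 1 else 0) eq) (sym (%2≡parity n)))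

¬sameBalance⇒sameBalance-suc : ∀ {m n} → ¬ SameBalance m n → SameBalance (suc m) n
¬sameBalance⇒sameBalance-suc {m} {n} ¬sb = parity≡⇒sameBalance {suc m} {n}
  (sym (¬-not λ eq → ¬sb (parity≡⇒sameBalance {m} {n} (sym eq))))

xor-commutativeMonoid : CommutativeMonoid _ _
xor-commutativeMonoid = CommutativeRing.+-commutativeMonoid xor-∧-commutativeRing

open import Algebra.Properties.CommutativeMonoid.Sum xor-commutativeMonoid
  using (sum; sum-cong-≗; ∑-distrib-+; sum-permute)

injective-endo⇒surjective : ∀ {n} (w : Fin n → Fin n) → Injective _≡_ _≡_ w → ∀ y → ∃[ x ] w x ≡ y
injective-endo⇒surjective {zero}  w w-inj ()
injective-endo⇒surjective {suc n} w w-inj y with any? (λ x → w x ≟ᶠ y)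
... | yes hit = hit
... | no miss = ⊥-elim (<-irrefl refl (injective⇒≤ {f = squeeze} squeeze-injective))
  where
  avoids : ∀ x → y ≢ w x
  avoids x eq = miss (x , sym eq)
  squeeze : Fin (suc n) → Fin n
  squeeze x = punchOut (avoids x)
  squeeze-injective : Injective _≡_ _≡_ squeeze
  squeeze-injective eq = w-inj (punchOut-injective (avoids _) (avoids _) eq)

sum-reindex : ∀ {m n} → m ≡ n → (w : Fin m → Fin n) → Injective _≡_ _≡_ w →
  (f : Fin n → Bool) → sum f ≡ sum (λ i → f (w i))
sum-reindex refl w w-inj f = sum-permute f π
  where
  surj = injective-endo⇒surjective w w-inj
  π : Permutation _ _
  π = permutation w (λ y → proj₁ (surj y)) (λ y → proj₂ (surj y)) (λ x → w-inj (proj₂ (surj (w x))))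

injective-suc⇒missed : ∀ {m n} → n ≡ suc m → (w : Fin m → Fin n) → Injective _≡_ _≡_ w →
  ∃[ y ] (∀ x → w x ≢ y)
injective-suc⇒missed {m} refl w w-inj with any? (λ y → ¬? (any? (λ x → w x ≟ᶠ y)))
... | yes (y , unhit) = y , λ x eq → unhit (x , eq)
... | no none = ⊥-elim (<-irrefl refl (injective⇒≤ {f = preimage} preimage-injective))
  where
  hit : ∀ y → ∃[ x ] w x ≡ y
  hit y with any? (λ x → w x ≟ᶠ y)
  ... | yes h = h
  ... | no h  = ⊥-elim (none (y , h))
  preimage : Fin (suc m) → Fin m
  preimage y = proj₁ (hit y)
  preimage-injective : Injective _≡_ _≡_ preimage
  preimage-injective {y} {y′} eq = trans (sym (proj₂ (hit y))) (trans (cong w eq) (proj₂ (hit y′)))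

sum-reindex-missing : ∀ {m n} → n ≡ suc m → (w : Fin m → Fin n) → Injective _≡_ _≡_ w →
  (y : Fin n) → (∀ x → w x ≢ y) → (f : Fin n → Bool) → sum f ≡ f y xor sum (λ j → f (w j))
sum-reindex-missing refl w w-inj y missed f = sum-reindex refl extended extended-injective f
  where
  extended : Fin _ → Fin _
  extended zero    = y
  extended (suc j) = w j
  extended-injective : Injective _≡_ _≡_ extended
  extended-injective {zero}  {zero}  _  = refl
  extended-injective {zero}  {suc j} eq = ⊥-elim (missed j (sym eq))
  extended-injective {suc i} {zero}  eq = ⊥-elim (missed i eq)
  extended-injective {suc i} {suc j} eq = cong suc (w-inj eq)

next-inject₁ : ∀ {m} (j : Fin m) → next {suc m} (inject₁ j) ≡ suc j
next-inject₁ {m} j = toℕ-injective (begin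
  toℕ (next (inject₁ j))         ≡⟨ toℕ-fromℕ< _ ⟩
  suc (toℕ (inject₁ j)) % suc m  ≡⟨ cong (λ x → suc x % suc m) (toℕ-inject₁ j) ⟩
  suc (toℕ j) % suc m            ≡⟨ m<n⇒m%n≡m (s≤s (toℕ<n j)) ⟩
  suc (toℕ j)                    ∎)
  where open ≡-Reasoning

next-fromℕ : ∀ m → next {suc m} (fromℕ m) ≡ zero
next-fromℕ m = toℕ-injective (begin
  toℕ (next (fromℕ m))     ≡⟨ toℕ-fromℕ< _ ⟩
  suc (toℕ (fromℕ m)) % suc m ≡⟨ cong (λ x → suc x % suc m) (toℕ-fromℕ m) ⟩
  suc m % suc m            ≡⟨ n%n≡0 (suc m) ⟩
  0                        ∎)
  where open ≡-Reasoning

lastOrInject₁ : ∀ {m} (i : Fin (suc m)) → i ≡ fromℕ m ⊎ ∃[ j ] i ≡ inject₁ j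
lastOrInject₁ {zero}  zero    = inj₁ refl
lastOrInject₁ {suc m} zero    = inj₂ (zero , refl)
lastOrInject₁ {suc m} (suc i) with lastOrInject₁ i
... | inj₁ eq       = inj₁ (cong suc eq)
... | inj₂ (j , eq) = inj₂ (suc j , cong suc eq)

next-injective : ∀ {n} → Injective _≡_ _≡_ (next {n})
next-injective {suc m} {i} {j} eq with lastOrInject₁ i | lastOrInject₁ j
... | inj₁ refl        | inj₁ refl        = refl
... | inj₁ refl        | inj₂ (j′ , refl) with () ← trans (sym (next-fromℕ m)) (trans eq (next-inject₁ j′))
... | inj₂ (i′ , refl) | inj₁ refl        with () ← trans (sym (next-inject₁ i′)) (trans eq (next-fromℕ m))
... | inj₂ (i′ , refl) | inj₂ (j′ , refl) =
  cong inject₁ (suc-injective (trans (sym (next-inject₁ i′)) (trans eq (next-inject₁ j′))))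

-- Each value of h enters the sum twice, once as h i and once as h (next i).
sum-around-cycle : ∀ {n} (h : Fin n → Bool) → sum (λ i → h i xor h (next i)) ≡ false
sum-around-cycle h = begin
  sum (λ i → h i xor h (next i))     ≡⟨ ∑-distrib-+ h (λ i → h (next i)) ⟩
  sum h xor sum (λ i → h (next i))   ≡⟨ cong (sum h xor_) (sym (sum-reindex refl next next-injective h)) ⟩
  sum h xor sum h                    ≡⟨ xor-same (sum h) ⟩
  false                              ∎
  where open ≡-Reasoning

isNegative : Sign → Bool
isNegative pos = false
isNegative neg = true

parity-negCount : ∀ n (σ : Fin n → Sign) → parity (negCount n σ) ≡ sum (λ i → isNegative (σ i))
parity-negCount zero    σ = refl
parity-negCount (suc n) σ with σ zero
... | pos = parity-negCount n (λ i → σ (suc i))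
... | neg = cong not (parity-negCount n (λ i → σ (suc i)))

isNegative-flipIf : ∀ b s → isNegative (flipIf b s) ≡ b xor isNegative s
isNegative-flipIf false s   = refl
isNegative-flipIf true  pos = refl
isNegative-flipIf true  neg = refl

flipIf-difference : ∀ s t → flipIf (isNegative s xor isNegative t) s ≡ t
flipIf-difference pos pos = refl
flipIf-difference pos neg = refl
flipIf-difference neg pos = refl
flipIf-difference neg neg = refl

prefixSum : ∀ {n} → (Fin n → Bool) → Fin n → Bool
prefixSum f zero    = false
prefixSum f (suc i) = f zero xor prefixSum (λ j → f (suc j)) i

prefixSum-suc : ∀ {m} (f : Fin (suc m) → Bool) (j : Fin m) →
  prefixSum f (suc j) ≡ prefixSum f (inject₁ j) xor f (inject₁ j)
prefixSum-suc f zero    = xor-identityʳ (f zero)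
prefixSum-suc f (suc j) =
  trans (cong (f zero xor_) (prefixSum-suc (λ i → f (suc i)) j)) (sym (xor-assoc (f zero) _ _))

prefixSum-last : ∀ m (f : Fin (suc m) → Bool) → prefixSum f (fromℕ m) xor f (fromℕ m) ≡ sum f
prefixSum-last zero    f = sym (xor-identityʳ _)
prefixSum-last (suc m) f = trans (xor-assoc (f zero) _ _) (cong (f zero xor_) (prefixSum-last m (λ i → f (suc i))))

xor-cancelˡ : ∀ a b → a xor (a xor b) ≡ b
xor-cancelˡ false b = refl
xor-cancelˡ true  b = not-involutive b

prefixSum-around-cycle : ∀ {m} (f : Fin (suc m) → Bool) → sum f ≡ false →
  ∀ i → prefixSum f i xor prefixSum f (next i) ≡ f i
prefixSum-around-cycle {m} f total i with lastOrInject₁ i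
... | inj₁ refl = begin
  P (fromℕ m) xor P (next (fromℕ m))     ≡⟨ cong (λ x → P (fromℕ m) xor P x) (next-fromℕ m) ⟩
  P (fromℕ m) xor false                  ≡⟨ cong (P (fromℕ m) xor_) (sym (trans (prefixSum-last m f) total)) ⟩
  P (fromℕ m) xor (P (fromℕ m) xor f (fromℕ m)) ≡⟨ xor-cancelˡ (P (fromℕ m)) _ ⟩
  f (fromℕ m)                            ∎
  where
  open ≡-Reasoning
  P = prefixSum f
... | inj₂ (j , refl) = begin
  P (inject₁ j) xor P (next (inject₁ j)) ≡⟨ cong (λ x → P (inject₁ j) xor P x) (next-inject₁ j) ⟩
  P (inject₁ j) xor P (suc j)            ≡⟨ cong (P (inject₁ j) xor_) (prefixSum-suc f j) ⟩
  P (inject₁ j) xor (P (inject₁ j) xor f (inject₁ j)) ≡⟨ xor-cancelˡ (P (inject₁ j)) _ ⟩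
  f (inject₁ j)                          ∎
  where
  open ≡-Reasoning
  P = prefixSum f

sameParity⇒switchable : ∀ n (σ τ : Signature (Cycle n)) →
  sum (λ i → isNegative (σ i)) ≡ sum (λ i → isNegative (τ i)) →
  ∃[ S ] (∀ i → switch (Cycle n) S σ i ≡ τ i)
sameParity⇒switchable zero    σ τ _  = (λ ()) , λ ()
sameParity⇒switchable (suc m) σ τ eq = prefixSum d , λ i →
  trans (cong (λ b → flipIf b (σ i)) (prefixSum-around-cycle d d-total i)) (flipIf-difference (σ i) (τ i))
  where
  d : Fin (suc m) → Bool
  d i = isNegative (σ i) xor isNegative (τ i)
  d-total : sum d ≡ false
  d-total = trans (∑-distrib-+ (λ i → isNegative (σ i)) (λ i → isNegative (τ i)))
    (trans (cong (sum (λ i → isNegative (σ i)) xor_) (sym eq)) (xor-same (sum (λ i → isNegative (σ i)))))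

-- Closed walks in K_k^* and complete colourings

record Arc : Set where
  constructor arc
  field
    from to : ℕ
    sign    : Sign
open Arc

data Walk : ℕ → ℕ → List Arc → Set where
  done : ∀ {x} → Walk x x []
  step : ∀ {x y z s as} → Walk y z as → Walk x z (arc x y s ∷ as)

walk-++ : ∀ {x y z as bs} → Walk x y as → Walk y z bs → Walk x z (as ++ bs)
walk-++ done       q = q
walk-++ (step p) q = step (walk-++ p q)

walk-linked : ∀ {x y a as} → Walk x y (a ∷ as) → ∀ (j : Fin (length as)) →
  from (lookup as j) ≡ to (lookup (a ∷ as) (inject₁ j))
walk-linked (step (step w)) zero = refl
walk-linked {as = _ ∷ _} (step w) (suc j) = walk-linked w j

walk-lastStep : ∀ {x y a as} → Walk x y (a ∷ as) → to (lookup (a ∷ as) (fromℕ (length as))) ≡ y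
walk-lastStep (step done)     = refl
walk-lastStep (step (step w)) = walk-lastStep (step w)

closedWalk-linked : ∀ {x as} → Walk x x as → ∀ i → from (lookup as (next i)) ≡ to (lookup as i)
closedWalk-linked {as = a ∷ as} w@(step _) i with lastOrInject₁ i
... | inj₁ refl = trans (cong (λ j → from (lookup (a ∷ as) j)) (next-fromℕ (length as))) (sym (walk-lastStep w))
... | inj₂ (j , refl) = trans (cong (λ j′ → from (lookup (a ∷ as) j′)) (next-inject₁ j)) (walk-linked w j)

negatives : List Arc → ℕ
negatives []       = 0
negatives (a ∷ as) with sign a
... | pos = negatives as
... | neg = suc (negatives as)

parity-negatives : ∀ as → parity (negatives as) ≡ sum (λ i → isNegative (sign (lookup as i)))
parity-negatives []                 = refl
parity-negatives (arc _ _ pos ∷ as) = parity-negatives as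
parity-negatives (arc _ _ neg ∷ as) = cong not (parity-negatives as)

-- For P = KVert k: e traverses an edge of K_k^*.
record ArcOver (P : ℕ → Set) (e : Arc) : Set where
  constructor arcOver
  field
    from∈         : P (from e)
    to∈           : P (to e)
    loop-negative : from e ≡ to e → from e ≢ 0 × sign e ≡ neg

Joins : ℕ → ℕ → Sign → Arc → Set
Joins a b s e = ((from e ≡ a × to e ≡ b) ⊎ (from e ≡ b × to e ≡ a)) × sign e ≡ s

NegativeLoopAt : ℕ → Arc → Set
NegativeLoopAt a e = from e ≡ a × to e ≡ a × sign e ≡ neg

record Covers (k : ℕ) (as : List Arc) : Set where
  field
    covers-vertex : ∀ a → KVert k a → Any (λ e → from e ≡ a) as
    covers-pair   : ∀ a b → KVert k a → KVert k b → a < b → ∀ s → Any (Joins a b s) as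
    covers-loop   : ∀ a → KVert k a → a ≢ 0 → Any (NegativeLoopAt a) as
open Covers

reducedArc : ∀ {n} → Signature (Cycle n) → (Fin n → ℤ) → Fin n → Arc
reducedArc {n} σ φ i = arc ∣ φ i ∣ ∣ φ (next i) ∣ (redSign (Cycle n) σ φ i)

complete-if-reducedArcs : ∀ {k} as (σ : Signature (Cycle (length as))) (φ : Fin (length as) → ℤ) →
  (∀ i → reducedArc σ φ i ≡ lookup as i) → All (ArcOver (KVert k)) as → Covers k as →
  Complete (Cycle (length as)) σ k φ
complete-if-reducedArcs {k} as σ φ reduced arcs cov =
  ArcOver.from∈ ∘ arcAt , (λ a ka → atIndex (covers-vertex cov a ka)) ,
  ArcOver.loop-negative ∘ arcAt , pairs , (λ a ka a≢0 → atIndex (covers-loop cov a ka a≢0))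
  where
  arcAt : ∀ i → ArcOver (KVert k) (reducedArc σ φ i)
  arcAt i = subst (ArcOver (KVert k)) (sym (reduced i)) (All.lookup arcs (∈-lookup i))
  atIndex : ∀ {P : Arc → Set} → Any P as → ∃[ i ] P (reducedArc σ φ i)
  atIndex {P} p = index p , subst P (sym (reduced (index p))) (lookup-index p)
  pairs : ∀ a b → KVert k a → KVert k b → a ≢ b → ∀ s → ∃[ i ] Joins a b s (reducedArc σ φ i)
  pairs a b ka kb a≢b s with <-cmp a b
  ... | tri< a<b _ _ = atIndex (covers-pair cov a b ka kb a<b s)
  ... | tri≈ _ a≡b _ = ⊥-elim (a≢b a≡b)
  ... | tri> _ _ b<a = Product.map₂ (Product.map₁ Sum.swap) (atIndex (covers-pair cov b a kb ka b<a s))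

-- Colour the i-th vertex of the cycle by the start of the i-th arc, and switch σ to the arc signs.
closedWalk⇒complete : ∀ {k x} n (as : List Arc) (σ : Signature (Cycle n)) → n ≡ length as →
  Walk x x as → All (ArcOver (KVert k)) as → Covers k as →
  parity (negCount n σ) ≡ parity (negatives as) → HasCompleteColouring (Cycle n) σ k
closedWalk⇒complete .(length as) as σ refl w arcs cov par =
  S , φ , complete-if-reducedArcs as (switch (Cycle (length as)) S σ) φ reduced arcs cov
  where
  switchable = sameParity⇒switchable (length as) σ (λ i → sign (lookup as i))
    (trans (sym (parity-negCount _ σ)) (trans par (parity-negatives as)))
  S = proj₁ switchable
  φ : Fin (length as) → ℤ
  φ i = ℤ.+ from (lookup as i)
  reduced : ∀ i → reducedArc (switch (Cycle (length as)) S σ) φ i ≡ lookup as i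
  reduced i = cong₂ (arc (from (lookup as i))) (closedWalk-linked w i) (proj₂ switchable i)

-- Euler tours

Between : ℕ → ℕ → ℕ → Set
Between a b v = a ≤ v × v ≤ b

loopAt : ℕ → List Arc
loopAt zero    = []
loopAt (suc a) = [ arc (suc a) (suc a) neg ]

fan : ℕ → ℕ → ℕ → List Arc
fan a b zero    = []
fan a b (suc c) = arc a b pos ∷ arc b a neg ∷ fan a (suc b) c

-- An Euler tour from a of the analogue of K_k^* on the vertices a, …, a+r.
tour : ℕ → ℕ → List Arc
tour a zero    = loopAt a
tour a (suc r) = loopAt a ++ arc a (suc a) pos ∷ tour (suc a) r ++ arc (suc a) a neg ∷ fan a (suc (suc a)) r

walk-loopAt : ∀ a → Walk a a (loopAt a)
walk-loopAt zero    = done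
walk-loopAt (suc a) = step done

walk-fan : ∀ a b c → Walk a a (fan a b c)
walk-fan a b zero    = done
walk-fan a b (suc c) = step (step (walk-fan a (suc b) c))

walk-tour : ∀ a r → Walk a a (tour a r)
walk-tour a zero    = walk-loopAt a
walk-tour a (suc r) =
  walk-++ (walk-loopAt a) (step (walk-++ (walk-tour (suc a) r) (step (walk-fan a (suc (suc a)) r))))

arcOver-map : ∀ {P Q : ℕ → Set} → (∀ {v} → P v → Q v) → ∀ {e} → ArcOver P e → ArcOver Q e
arcOver-map f (arcOver p q loop) = arcOver (f p) (f q) loop

arcOver-nonLoop : ∀ {P : ℕ → Set} {e} → from e ≢ to e → P (from e) → P (to e) → ArcOver P e
arcOver-nonLoop nonLoop p q = arcOver p q λ loop → ⊥-elim (nonLoop loop)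

arcs-loopAt : ∀ {L H} a → L ≤ a → a ≤ H → All (ArcOver (Between L H)) (loopAt a)
arcs-loopAt zero    _   _   = []
arcs-loopAt (suc a) L≤a a≤H = arcOver (L≤a , a≤H) (L≤a , a≤H) (λ _ → (λ ()) , refl) ∷ []

arcs-fan : ∀ {L H} a b c → L ≤ a → a < b → b + c ≤ suc H → All (ArcOver (Between L H)) (fan a b c)
arcs-fan a b zero    _   _   _        = []
arcs-fan {L} {H} a b (suc c) L≤a a<b b+c<H =
  arcOver-nonLoop (<⇒≢ a<b) (L≤a , a≤H) (L≤b , b≤H) ∷
  arcOver-nonLoop (<⇒≢ a<b ∘ sym) (L≤b , b≤H) (L≤a , a≤H) ∷
  arcs-fan a (suc b) c L≤a (m<n⇒m<1+n a<b) (≤-trans (≤-reflexive (sym (+-suc b c))) b+c<H)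
  where
  b≤H : b ≤ _
  b≤H = ≤-pred (≤-trans (s≤s (m≤m+n b c)) (≤-trans (≤-reflexive (sym (+-suc b c))) b+c<H))
  a≤H = ≤-trans (<⇒≤ a<b) b≤H
  L≤b = ≤-trans L≤a (<⇒≤ a<b)

arcs-tour : ∀ a r → All (ArcOver (Between a (a + r))) (tour a r)
arcs-tour a zero    = arcs-loopAt a ≤-refl (≤-reflexive (sym (+-identityʳ a)))
arcs-tour a (suc r) = AllP.++⁺ (arcs-loopAt a ≤-refl a≤H)
  (arcOver-nonLoop (<⇒≢ (n<1+n a)) (≤-refl , a≤H) (n≤1+n a , a+1≤H) ∷
   AllP.++⁺ (All.map (arcOver-map inner) (arcs-tour (suc a) r))
     (arcOver-nonLoop (<⇒≢ (n<1+n a) ∘ sym) (n≤1+n a , a+1≤H) (≤-refl , a≤H) ∷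
      arcs-fan a (suc (suc a)) r ≤-refl (≤-trans (n<1+n a) (n≤1+n (suc a))) (s≤s (≤-reflexive (sym (+-suc a r))))))
  where
  a+1≤H : suc a ≤ a + suc r
  a+1≤H = ≤-trans (s≤s (m≤m+n a r)) (≤-reflexive (sym (+-suc a r)))
  a≤H = ≤-trans (n≤1+n a) a+1≤H
  inner : ∀ {v} → Between (suc a) (suc a + r) v → Between a (a + suc r) v
  inner (a<v , v≤H) = <⇒≤ a<v , ≤-trans v≤H (≤-reflexive (sym (+-suc a r)))

tour-covers-vertex : ∀ a r x → a ≤ x → x ≤ a + r → 0 < a ⊎ 0 < r → Any (λ e → from e ≡ x) (tour a r)
tour-covers-vertex zero    zero    x _   _   (inj₁ ())
tour-covers-vertex zero    zero    x _   _   (inj₂ ())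
tour-covers-vertex (suc a) zero    x a≤x x≤a _ =
  here (≤-antisym a≤x (≤-trans x≤a (≤-reflexive (+-identityʳ (suc a)))))
tour-covers-vertex a       (suc r) x a≤x x≤H _ with m≤n⇒m<n∨m≡n a≤x
... | inj₂ refl = AnyP.++⁺ʳ (loopAt a) (here refl)
... | inj₁ a<x  = AnyP.++⁺ʳ (loopAt a) (there (AnyP.++⁺ˡ
  (tour-covers-vertex (suc a) r x a<x (≤-trans x≤H (≤-reflexive (+-suc a r))) (inj₁ z<s))))

tour-covers-loop : ∀ a r x → a ≤ x → x ≤ a + r → x ≢ 0 → Any (NegativeLoopAt x) (tour a r)
tour-covers-loop zero    r       zero    _   _   x≢0 = ⊥-elim (x≢0 refl)
tour-covers-loop zero    zero    (suc x) _   ()  _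
tour-covers-loop (suc a) zero    x       a≤x x≤a _
  with refl ← ≤-antisym a≤x (≤-trans x≤a (≤-reflexive (+-identityʳ (suc a)))) = here (refl , refl , refl)
tour-covers-loop a       (suc r) x       a≤x x≤H x≢0 with m≤n⇒m<n∨m≡n a≤x
tour-covers-loop zero    (suc r) _ _ _ x≢0 | inj₂ refl = ⊥-elim (x≢0 refl)
tour-covers-loop (suc a) (suc r) _ _ _ _   | inj₂ refl = here (refl , refl , refl)
... | inj₁ a<x = AnyP.++⁺ʳ (loopAt a) (there (AnyP.++⁺ˡ
  (tour-covers-loop (suc a) r x a<x (≤-trans x≤H (≤-reflexive (+-suc a r))) x≢0)))

fan-covers : ∀ a b c y → b ≤ y → y < b + c → ∀ s → Any (Joins a y s) (fan a b c)
fan-covers a b zero    y b≤y y<b _ =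
  ⊥-elim (<-irrefl refl (≤-trans y<b (≤-trans (≤-reflexive (+-identityʳ b)) b≤y)))
fan-covers a b (suc c) y b≤y y<H s with m≤n⇒m<n∨m≡n b≤y
fan-covers a b (suc c) _ _ _ pos | inj₂ refl = here (inj₁ (refl , refl) , refl)
fan-covers a b (suc c) _ _ _ neg | inj₂ refl = there (here (inj₂ (refl , refl) , refl))
... | inj₁ b<y = there (there (fan-covers a (suc b) c y b<y (≤-trans y<H (≤-reflexive (+-suc b c))) s))

tour-covers-pair : ∀ a r x y → a ≤ x → x < y → y ≤ a + r → ∀ s → Any (Joins x y s) (tour a r)
tour-covers-pair a zero    x y a≤x x<y y≤a _ =
  ⊥-elim (<-irrefl refl (≤-trans x<y (≤-trans y≤a (≤-trans (≤-reflexive (+-identityʳ a)) a≤x))))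
tour-covers-pair a (suc r) x y a≤x x<y y≤H s with m≤n⇒m<n∨m≡n a≤x
... | inj₁ a<x = AnyP.++⁺ʳ (loopAt a) (there (AnyP.++⁺ˡ
  (tour-covers-pair (suc a) r x y a<x x<y (≤-trans y≤H (≤-reflexive (+-suc a r))) s)))
... | inj₂ refl with m≤n⇒m<n∨m≡n x<y
...   | inj₂ refl with s
...     | pos = AnyP.++⁺ʳ (loopAt a) (here (inj₁ (refl , refl) , refl))
...     | neg = AnyP.++⁺ʳ (loopAt a) (there (AnyP.++⁺ʳ (tour (suc a) r) (here (inj₂ (refl , refl) , refl))))
tour-covers-pair a (suc r) x y a≤x x<y y≤H s | inj₂ refl | inj₁ a+1<y =
  AnyP.++⁺ʳ (loopAt a) (there (AnyP.++⁺ʳ (tour (suc a) r) (there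
    (fan-covers a (suc (suc a)) r y a+1<y (s≤s (≤-trans y≤H (≤-reflexive (+-suc a r)))) s))))

tour-covers : ∀ {k} a r → (∀ {v} → KVert k v → Between a (a + r) v) → 0 < a ⊎ 0 < r → Covers k (tour a r)
tour-covers a r range nonempty = record
  { covers-vertex = λ v kv → tour-covers-vertex a r v (proj₁ (range kv)) (proj₂ (range kv)) nonempty
  ; covers-pair   = λ v w kv kw v<w s → tour-covers-pair a r v w (proj₁ (range kv)) v<w (proj₂ (range kw)) s
  ; covers-loop   = λ v kv v≢0 → tour-covers-loop a r v (proj₁ (range kv)) (proj₂ (range kv)) v≢0
  }

negatives-++ : ∀ as bs → negatives (as ++ bs) ≡ negatives as + negatives bs
negatives-++ []                 bs = refl
negatives-++ (arc _ _ pos ∷ as) bs = negatives-++ as bs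
negatives-++ (arc _ _ neg ∷ as) bs = cong suc (negatives-++ as bs)

length-fan : ∀ a b c → length (fan a b c) ≡ c + c
length-fan a b zero    = refl
length-fan a b (suc c) = cong suc (trans (cong suc (length-fan a (suc b) c)) (sym (+-suc c c)))

negatives-fan : ∀ a b c → negatives (fan a b c) ≡ c
negatives-fan a b zero    = refl
negatives-fan a b (suc c) = cong suc (negatives-fan a (suc b) c)

negatives-loopAt : ∀ a → negatives (loopAt a) ≡ length (loopAt a)
negatives-loopAt zero    = refl
negatives-loopAt (suc a) = refl

C2-suc : ∀ r → suc r C 2 ≡ r + r C 2
C2-suc r = trans (sym (nCk+nC[k+1]≡[n+1]C[k+1] r 1)) (cong (_+ r C 2) (nC1≡n r))

length-tour : ∀ a r → length (tour a r) ≡ 2 * (suc r C 2) + r + length (loopAt a)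
length-tour a zero    = refl
length-tour a (suc r) = begin
  length (loopAt a ++ arc a (suc a) pos ∷ tour (suc a) r ++ arc (suc a) a neg ∷ fan a (suc (suc a)) r)
    ≡⟨ length-++ (loopAt a) ⟩
  L + suc (length (tour (suc a) r ++ arc (suc a) a neg ∷ fan a (suc (suc a)) r))
    ≡⟨ cong (λ x → L + suc x) (length-++ (tour (suc a) r)) ⟩
  L + suc (length (tour (suc a) r) + suc (length (fan a (suc (suc a)) r)))
    ≡⟨ cong₂ (λ x y → L + suc (x + suc y)) (length-tour (suc a) r) (length-fan a (suc (suc a)) r) ⟩
  L + suc (2 * (suc r C 2) + r + 1 + suc (r + r))
    ≡⟨ arith L (suc r C 2) r ⟩
  2 * (suc r + suc r C 2) + suc r + L
    ≡⟨ cong (λ x → 2 * x + suc r + L) (sym (C2-suc (suc r))) ⟩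
  2 * (suc (suc r) C 2) + suc r + L ∎
  where
  open ≡-Reasoning
  L = length (loopAt a)
  arith : ∀ l t r → l + suc (2 * t + r + 1 + suc (r + r)) ≡ 2 * (suc r + t) + suc r + l
  arith = solve-∀

negatives-tour : ∀ a r → negatives (tour a r) ≡ suc r C 2 + r + length (loopAt a)
negatives-tour a zero    = negatives-loopAt a
negatives-tour a (suc r) = begin
  negatives (loopAt a ++ arc a (suc a) pos ∷ tour (suc a) r ++ arc (suc a) a neg ∷ fan a (suc (suc a)) r)
    ≡⟨ negatives-++ (loopAt a) _ ⟩
  negatives (loopAt a) + negatives (tour (suc a) r ++ arc (suc a) a neg ∷ fan a (suc (suc a)) r)
    ≡⟨ cong₂ _+_ (negatives-loopAt a) (negatives-++ (tour (suc a) r) _) ⟩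
  L + (negatives (tour (suc a) r) + suc (negatives (fan a (suc (suc a)) r)))
    ≡⟨ cong₂ (λ x y → L + (x + suc y)) (negatives-tour (suc a) r) (negatives-fan a (suc (suc a)) r) ⟩
  L + (suc r C 2 + r + 1 + suc r)
    ≡⟨ arith L (suc r C 2) r ⟩
  (suc r + suc r C 2) + suc r + L
    ≡⟨ cong (λ x → x + suc r + L) (sym (C2-suc (suc r))) ⟩
  suc (suc r) C 2 + suc r + L ∎
  where
  open ≡-Reasoning
  L = length (loopAt a)
  arith : ∀ l t r → l + (t + r + 1 + suc r) ≡ (suc r + t) + suc r + l
  arith = solve-∀

SameEdge : Arc → Arc → Set
SameEdge e e′ =
  sign e ≡ sign e′ × ((from e ≡ from e′ × to e ≡ to e′) ⊎ (from e ≡ to e′ × to e ≡ from e′))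

sameEdge-sym : ∀ {e e′} → SameEdge e e′ → SameEdge e′ e
sameEdge-sym (s , inj₁ (p , q)) = sym s , inj₁ (sym p , sym q)
sameEdge-sym (s , inj₂ (p , q)) = sym s , inj₂ (sym q , sym p)

sameEdge-trans : ∀ {e e′ e″} → SameEdge e e′ → SameEdge e′ e″ → SameEdge e e″
sameEdge-trans (s , inj₁ (p , q)) (s′ , inj₁ (p′ , q′)) = trans s s′ , inj₁ (trans p p′ , trans q q′)
sameEdge-trans (s , inj₁ (p , q)) (s′ , inj₂ (p′ , q′)) = trans s s′ , inj₂ (trans p p′ , trans q q′)
sameEdge-trans (s , inj₂ (p , q)) (s′ , inj₁ (p′ , q′)) = trans s s′ , inj₂ (trans p q′ , trans q p′)
sameEdge-trans (s , inj₂ (p , q)) (s′ , inj₂ (p′ , q′)) = trans s s′ , inj₁ (trans p q′ , trans q p′)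

DifferentEdge : Arc → Arc → Set
DifferentEdge e e′ = ¬ SameEdge e e′

Distinct : List Arc → Set
Distinct = AllPairs DifferentEdge

distinct-lookup : ∀ {as} → Distinct as → ∀ i j → SameEdge (lookup as i) (lookup as j) → i ≡ j
distinct-lookup (_  ∷ _) zero    zero    _ = refl
distinct-lookup (ds ∷ _) zero    (suc j) e = ⊥-elim (All.lookup ds (∈-lookup j) e)
distinct-lookup (ds ∷ _) (suc i) zero    e = ⊥-elim (All.lookup ds (∈-lookup i) (sameEdge-sym e))
distinct-lookup (_ ∷ d)  (suc i) (suc j) e = cong suc (distinct-lookup d i j e)

Touches : Arc → ℕ → Set
Touches e v = from e ≡ v ⊎ to e ≡ v

Avoids : ℕ → Arc → Set
Avoids v e = from e ≢ v × to e ≢ v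

touches⇒different : ∀ {e e′ v} → Touches e v → Avoids v e′ → DifferentEdge e e′
touches⇒different (inj₁ refl) (a₁ , a₂) (_ , inj₁ (p , _)) = a₁ (sym p)
touches⇒different (inj₁ refl) (a₁ , a₂) (_ , inj₂ (p , _)) = a₂ (sym p)
touches⇒different (inj₂ refl) (a₁ , a₂) (_ , inj₁ (_ , q)) = a₂ (sym q)
touches⇒different (inj₂ refl) (a₁ , a₂) (_ , inj₂ (_ , q)) = a₁ (sym q)

avoids⇒different : ∀ {e e′ v} → Avoids v e → Touches e′ v → DifferentEdge e e′
avoids⇒different avoid touch same = touches⇒different touch avoid (sameEdge-sym same)

signs⇒different : ∀ {e e′} → sign e ≢ sign e′ → DifferentEdge e e′
signs⇒different s≢s′ (s≡s′ , _) = s≢s′ s≡s′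

loop⇒different : ∀ {e e′} → from e ≡ to e → from e′ ≢ to e′ → DifferentEdge e e′
loop⇒different loop nonLoop (_ , inj₁ (p , q)) = nonLoop (trans (sym p) (trans loop q))
loop⇒different loop nonLoop (_ , inj₂ (p , q)) = nonLoop (trans (sym q) (trans (sym loop) p))

pos≢neg : pos ≢ neg
pos≢neg ()

between⇒avoids : ∀ {L H v e} → v < L → ArcOver (Between L H) e → Avoids v e
between⇒avoids v<L (arcOver (L≤from , _) (L≤to , _) _) =
    (λ eq → <⇒≱ v<L (≤-trans L≤from (≤-reflexive eq)))
  , (λ eq → <⇒≱ v<L (≤-trans L≤to (≤-reflexive eq)))

data FanArc (a b : ℕ) (e : Arc) : Set where
  outward : from e ≡ a → b ≤ to e   → FanArc a b e
  inward  : to e ≡ a   → b ≤ from e → FanArc a b e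

fanArcs : ∀ a b c → All (FanArc a b) (fan a b c)
fanArcs a b zero    = []
fanArcs a b (suc c) = outward refl ≤-refl ∷ inward refl ≤-refl ∷ All.map weaken (fanArcs a (suc b) c)
  where
  weaken : ∀ {e} → FanArc a (suc b) e → FanArc a b e
  weaken (outward p q) = outward p (<⇒≤ q)
  weaken (inward  p q) = inward  p (<⇒≤ q)

fanArc-avoids : ∀ {a b v e} → a ≢ v → v < b → FanArc a b e → Avoids v e
fanArc-avoids a≢v v<b (outward p q) = (a≢v ∘ trans (sym p)) , (λ eq → <⇒≱ v<b (≤-trans q (≤-reflexive eq)))
fanArc-avoids a≢v v<b (inward  p q) = (λ eq → <⇒≱ v<b (≤-trans q (≤-reflexive eq))) , (a≢v ∘ trans (sym p))

fanArc-nonLoop : ∀ {a b e} → a < b → FanArc a b e → from e ≢ to e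
fanArc-nonLoop a<b (outward p q) eq = <⇒≱ a<b (≤-trans q (≤-reflexive (trans (sym eq) p)))
fanArc-nonLoop a<b (inward  p q) eq = <⇒≱ a<b (≤-trans q (≤-reflexive (trans eq p)))

distinct-fan : ∀ a b c → a < b → Distinct (fan a b c)
distinct-fan a b zero    _   = []
distinct-fan a b (suc c) a<b =
  (signs⇒different pos≢neg ∷ All.map (touches⇒different (inj₂ refl) ∘ avoidsB) rest) ∷
  All.map (touches⇒different (inj₁ refl) ∘ avoidsB) rest ∷
  distinct-fan a (suc b) c (m<n⇒m<1+n a<b)
  where
  rest = fanArcs a (suc b) c
  avoidsB : ∀ {e} → FanArc a (suc b) e → Avoids b e
  avoidsB = fanArc-avoids (<⇒≢ a<b) (n<1+n b)

distinct-loopAt : ∀ a → Distinct (loopAt a)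
distinct-loopAt zero    = []
distinct-loopAt (suc a) = [] ∷ []

distinct-tour : ∀ a r → Distinct (tour a r)
distinct-tour a zero    = distinct-loopAt a
distinct-tour a (suc r) = APP.++⁺ (distinct-loopAt a) distinct-rest (loop-vs-rest a refl)
  where
  inner = tour (suc a) r
  outer = fan a (suc (suc a)) r
  up    = arc a (suc a) pos
  down  = arc (suc a) a neg
  rest  = up ∷ inner ++ down ∷ outer
  a<a+2 = ≤-trans (n<1+n a) (n≤1+n (suc a))
  inner-avoids : All (Avoids a) inner
  inner-avoids = All.map (between⇒avoids (n<1+n a)) (arcs-tour (suc a) r)
  outer-arcs : All (FanArc a (suc (suc a))) outer
  outer-arcs = fanArcs a (suc (suc a)) r
  outer-avoids : All (Avoids (suc a)) outer
  outer-avoids = All.map (fanArc-avoids (<⇒≢ (n<1+n a)) (n<1+n (suc a))) outer-arcs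
  distinct-down : Distinct (down ∷ outer)
  distinct-down = All.map (touches⇒different (inj₁ refl)) outer-avoids ∷ distinct-fan a (suc (suc a)) r a<a+2
  inner-vs-down : All (λ e → All (DifferentEdge e) (down ∷ outer)) inner
  inner-vs-down = All.map (λ avoid → avoids⇒different avoid (inj₂ refl) ∷
    All.map (λ { (outward p _) → avoids⇒different avoid (inj₁ p)
               ; (inward  p _) → avoids⇒different avoid (inj₂ p) }) outer-arcs)
    inner-avoids
  distinct-rest : Distinct rest
  distinct-rest =
    AllP.++⁺ (All.map (touches⇒different (inj₁ refl)) inner-avoids)
             (signs⇒different pos≢neg ∷ All.map (touches⇒different (inj₂ refl)) outer-avoids)
    ∷ APP.++⁺ (distinct-tour (suc a) r) distinct-down inner-vs-down
  loop-vs-rest : ∀ a′ → a′ ≡ a → All (λ e → All (DifferentEdge e) rest) (loopAt a′)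
  loop-vs-rest zero     _    = []
  loop-vs-rest (suc a′) refl =
    (loop⇒different refl (<⇒≢ (n<1+n (suc a′))) ∷
     AllP.++⁺ (All.map (touches⇒different (inj₁ refl)) inner-avoids)
              (loop⇒different refl (<⇒≢ (n<1+n (suc a′)) ∘ sym) ∷
               All.map (loop⇒different refl ∘ fanArc-nonLoop a<a+2) outer-arcs))
    ∷ []

data Half : ℕ → Set where
  even : ∀ p → Half (p * 2)
  odd  : ∀ p → Half (suc (p * 2))

half : ∀ k → Half k
half zero    = even 0
half (suc k) with half k
... | even p = odd p
... | odd  p = even (suc p)

module _ (p : ℕ) where

  /2-even : p * 2 / 2 ≡ p
  /2-even = m*n/n≡m p 2

  %2-even : p * 2 % 2 ≡ 0
  %2-even = m*n%n≡0 p 2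

  /2-odd : suc (p * 2) / 2 ≡ p
  /2-odd = trans (+-distrib-/ 1 (p * 2) (≤-trans (s≤s (≤-reflexive (cong suc %2-even))) ≤-refl)) /2-even

  %2-odd : suc (p * 2) % 2 ≡ 1
  %2-odd = [m+kn]%n≡m%n 1 p 2

  kVerts-even : kVerts (p * 2) ≡ p
  kVerts-even = trans (cong₂ _+_ /2-even %2-even) (+-identityʳ p)

  kVerts-odd : kVerts (suc (p * 2)) ≡ suc p
  kVerts-odd = trans (cong₂ _+_ /2-odd %2-odd) (+-comm p 1)

  edgesK-even : edgesK (p * 2) ≡ 2 * (p C 2) + p
  edgesK-even = cong₂ (λ v h → 2 * (v C 2) + h) kVerts-even /2-even

  edgesK-odd : edgesK (suc (p * 2)) ≡ 2 * (suc p C 2) + p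
  edgesK-odd = cong₂ (λ v h → 2 * (v C 2) + h) kVerts-odd /2-odd

  negEdgesK-even : negEdgesK (p * 2) ≡ p C 2 + p
  negEdgesK-even = cong₂ (λ v h → v C 2 + h) kVerts-even /2-even

  negEdgesK-odd : negEdgesK (suc (p * 2)) ≡ suc p C 2 + p
  negEdgesK-odd = cong₂ (λ v h → v C 2 + h) kVerts-odd /2-odd

  kVert-even⇒between : ∀ {v} → KVert (p * 2) v → Between 1 p v
  kVert-even⇒between {zero}  (_ , nonzero) = ⊥-elim (nonzero %2-even refl)
  kVert-even⇒between {suc v} (v≤ , _)      = s≤s z≤n , ≤-trans v≤ (≤-reflexive /2-even)

  between⇒kVert-even : ∀ {v} → Between 1 p v → KVert (p * 2) v
  between⇒kVert-even (1≤v , v≤p) = ≤-trans v≤p (≤-reflexive (sym /2-even)) , λ _ → <⇒≢ 1≤v ∘ sym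

  kVert-odd⇒between : ∀ {v} → KVert (suc (p * 2)) v → Between 0 p v
  kVert-odd⇒between (v≤ , _) = z≤n , ≤-trans v≤ (≤-reflexive /2-odd)

  between⇒kVert-odd : ∀ {v} → Between 0 p v → KVert (suc (p * 2)) v
  between⇒kVert-odd (_ , v≤p) =
    ≤-trans v≤p (≤-reflexive (sym /2-odd)) , λ 1≡0 → ⊥-elim (1≢0 (trans (sym %2-odd) 1≡0))
    where
    1≢0 : 1 ≢ 0
    1≢0 ()

one∈K : ∀ k → 2 ≤ k → KVert k 1
one∈K k 2≤k = m≥n⇒m/n>0 2≤k , λ _ ()

edgesK-odd-step : ∀ p → edgesK (suc (p * 2)) ≡ edgesK (p * 2) + p * 2
edgesK-odd-step p = begin
  edgesK (suc (p * 2))      ≡⟨ edgesK-odd p ⟩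
  2 * (suc p C 2) + p       ≡⟨ cong (λ c → 2 * c + p) (C2-suc p) ⟩
  2 * (p + p C 2) + p       ≡⟨ arith p (p C 2) ⟩
  2 * (p C 2) + p + p * 2   ≡⟨ cong (_+ p * 2) (sym (edgesK-even p)) ⟩
  edgesK (p * 2) + p * 2    ∎
  where
  open ≡-Reasoning
  arith : ∀ p c → 2 * (p + c) + p ≡ 2 * c + p + p * 2
  arith = solve-∀

edgesK-even-step : ∀ p → edgesK (suc p * 2) ≡ suc (edgesK (suc (p * 2)))
edgesK-even-step p = trans (edgesK-even (suc p)) (trans (+-suc _ p) (cong suc (sym (edgesK-odd p))))

negEdgesK-even-step : ∀ p → negEdgesK (suc p * 2) ≡ suc (negEdgesK (suc (p * 2)))
negEdgesK-even-step p = trans (negEdgesK-even (suc p)) (trans (+-suc _ p) (cong suc (sym (negEdgesK-odd p))))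

edgesK-< : ∀ k → 1 ≤ k → edgesK k < edgesK (suc k)
edgesK-< k 1≤k with half k
edgesK-< .(0 * 2)     () | even zero
edgesK-< .(suc p * 2) _  | even (suc p) =
  ≤-trans (m<m+n (edgesK (suc p * 2)) z<s) (≤-reflexive (sym (edgesK-odd-step (suc p))))
edgesK-< .(suc (p * 2)) _ | odd p = ≤-reflexive (sym (edgesK-even-step p))

-- An Euler tour of K_k^*, split at a visit of vertex 1 so that closed walks at 1 can be spliced in.
record SplitTour (k : ℕ) : Set where
  field
    base         : ℕ
    before after : List Arc
    walk-before  : Walk base 1 before
    walk-after   : Walk 1 base after
    arcs         : All (ArcOver (KVert k)) (before ++ after)
    covers       : Covers k (before ++ after)
    distinct     : Distinct (before ++ after)
    length≡      : length (before ++ after) ≡ edgesK k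
    negatives≡   : negatives (before ++ after) ≡ negEdgesK k

splitTour : ∀ k → 2 ≤ k → SplitTour k
splitTour k 2≤k with half k
splitTour .(suc q * 2) _ | even (suc q) = record
  { base = 1 ; before = [] ; after = tour 1 q
  ; walk-before = done ; walk-after = walk-tour 1 q
  ; arcs = All.map (arcOver-map (between⇒kVert-even (suc q))) (arcs-tour 1 q)
  ; covers = tour-covers 1 q (kVert-even⇒between (suc q)) (inj₁ z<s)
  ; distinct = distinct-tour 1 q
  ; length≡ = trans (length-tour 1 q)
      (trans (+-assoc _ q 1) (trans (cong (λ m → 2 * (suc q C 2) + m) (+-comm q 1)) (sym (edgesK-even (suc q)))))
  ; negatives≡ = trans (negatives-tour 1 q)
      (trans (+-assoc _ q 1) (trans (cong (λ m → suc q C 2 + m) (+-comm q 1)) (sym (negEdgesK-even (suc q)))))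
  }
splitTour .(suc (suc q * 2)) _ | odd (suc q) = record
  { base = 0 ; before = [ arc 0 1 pos ] ; after = tour 1 q ++ arc 1 0 neg ∷ fan 0 2 q
  ; walk-before = step done ; walk-after = walk-++ (walk-tour 1 q) (step (walk-fan 0 2 q))
  ; arcs = All.map (arcOver-map (between⇒kVert-odd (suc q))) (arcs-tour 0 (suc q))
  ; covers = tour-covers 0 (suc q) (kVert-odd⇒between (suc q)) (inj₂ z<s)
  ; distinct = distinct-tour 0 (suc q)
  ; length≡ = trans (length-tour 0 (suc q)) (trans (+-identityʳ _) (sym (edgesK-odd (suc q))))
  ; negatives≡ = trans (negatives-tour 0 (suc q)) (trans (+-identityʳ _) (sym (negEdgesK-odd (suc q))))
  }
splitTour .(0 * 2)       () | even zero
splitTour .(suc (0 * 2)) (s≤s ()) | odd zero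

-- Obstructions from a complete colouring

degree : ℕ → Arc → Bool
degree v e = (from e ≡ᵇ v) xor (to e ≡ᵇ v)

walk-degree : ∀ {x y as} v → Walk x y as → sum (λ j → degree v (lookup as j)) ≡ (x ≡ᵇ v) xor (y ≡ᵇ v)
walk-degree {x} v done = sym (xor-same (x ≡ᵇ v))
walk-degree {x} v (step {y = y} {z = z} w) =
  trans (cong (((x ≡ᵇ v) xor (y ≡ᵇ v)) xor_) (walk-degree v w)) (telescope (x ≡ᵇ v) (y ≡ᵇ v) (z ≡ᵇ v))
  where
  telescope : ∀ a b c → (a xor b) xor (b xor c) ≡ a xor c
  telescope a b c = trans (xor-assoc a b (b xor c)) (cong (a xor_) (xor-cancelˡ b c))

sameEdge-degree : ∀ v {e e′} → SameEdge e e′ → degree v e ≡ degree v e′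
sameEdge-degree v (_ , inj₁ (p , q)) = cong₂ (λ a b → (a ≡ᵇ v) xor (b ≡ᵇ v)) p q
sameEdge-degree v {e′ = e′} (_ , inj₂ (p , q)) =
  trans (cong₂ (λ a b → (a ≡ᵇ v) xor (b ≡ᵇ v)) p q) (xor-comm (to e′ ≡ᵇ v) _)

≡ᵇ-refl : ∀ v → (v ≡ᵇ v) ≡ true
≡ᵇ-refl zero    = refl
≡ᵇ-refl (suc v) = ≡ᵇ-refl v

degree-false⇒loop : ∀ e → degree (from e) e ≡ false → from e ≡ to e
degree-false⇒loop e deg with to e ≡ᵇ from e in eq
... | true  = sym (≡ᵇ⇒≡ (to e) (from e) (subst T (sym eq) _))
... | false with () ← trans (sym (cong (_xor false) (≡ᵇ-refl (from e)))) deg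

module CompleteColouring {n k} (σ : Signature (Cycle n)) (S : Fin n → Bool) (φ : Fin n → ℤ)
  (complete : Complete (Cycle n) (switch (Cycle n) S σ) k φ) where

  reduced : Fin n → Arc
  reduced = reducedArc (switch (Cycle n) S σ) φ

  private
    loops-negative = proj₁ (proj₂ (proj₂ complete))
    pairs-joined   = proj₁ (proj₂ (proj₂ (proj₂ complete)))
    loops-present  = proj₂ (proj₂ (proj₂ (proj₂ complete)))

  -- Both switchings are by vertex sets, so each flips an even number of cycle edges.
  parity-reduced : sum (λ i → isNegative (sign (reduced i))) ≡ parity (negCount n σ)
  parity-reduced = begin
    sum (λ i → isNegative (sign (reduced i)))
      ≡⟨ sum-cong-≗ (λ i → trans (isNegative-flipIf (c i xor c (next i)) _)
                               (cong ((c i xor c (next i)) xor_) (isNegative-flipIf (S i xor S (next i)) (σ i)))) ⟩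
    sum (λ i → (c i xor c (next i)) xor ((S i xor S (next i)) xor isNegative (σ i)))
      ≡⟨ ∑-distrib-+ (λ i → c i xor c (next i)) _ ⟩
    sum (λ i → c i xor c (next i)) xor sum (λ i → (S i xor S (next i)) xor isNegative (σ i))
      ≡⟨ cong₂ _xor_ (sum-around-cycle c) (∑-distrib-+ (λ i → S i xor S (next i)) _) ⟩
    sum (λ i → S i xor S (next i)) xor sum (λ i → isNegative (σ i))
      ≡⟨ cong (_xor sum (λ i → isNegative (σ i))) (sum-around-cycle S) ⟩
    sum (λ i → isNegative (σ i))
      ≡⟨ sym (parity-negCount n σ) ⟩
    parity (negCount n σ) ∎
    where
    open ≡-Reasoning
    c : Fin n → Bool
    c i = isNeg (φ i)

  reduces-onto : ∀ {e} → ArcOver (KVert k) e → ∃[ i ] SameEdge (reduced i) e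
  reduces-onto {e} (arcOver from∈ to∈ loop-negative) with from e ≟ to e
  ... | yes loop
    with i , p , q , r ← loops-present (from e) from∈ (proj₁ (loop-negative loop))
    = i , trans r (sym (proj₂ (loop-negative loop))) , inj₁ (p , trans q loop)
  ... | no nonLoop with pairs-joined (from e) (to e) from∈ to∈ nonLoop (sign e)
  ...   | i , inj₁ ends , s = i , s , inj₁ ends
  ...   | i , inj₂ ends , s = i , s , inj₂ ends

  reduced-loop⇒negative : ∀ i → from (reduced i) ≡ to (reduced i) → sign (reduced i) ≡ neg
  reduced-loop⇒negative i loop = proj₂ (loops-negative i loop)

  module Embedding (as : List Arc) (arcs : All (ArcOver (KVert k)) as) (distinct : Distinct as) where

    embed : Fin (length as) → Fin n
    embed j = proj₁ (reduces-onto (All.lookup arcs (∈-lookup j)))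

    embed-sameEdge : ∀ j → SameEdge (reduced (embed j)) (lookup as j)
    embed-sameEdge j = proj₂ (reduces-onto (All.lookup arcs (∈-lookup j)))

    embed-injective : Injective _≡_ _≡_ embed
    embed-injective {j} {j′} eq = distinct-lookup distinct j j′
      (sameEdge-trans (sameEdge-sym (embed-sameEdge j))
        (subst (λ i → SameEdge (reduced i) (lookup as j′)) (sym eq) (embed-sameEdge j′)))

    length≤n : length as ≤ n
    length≤n = injective⇒≤ embed-injective

    sum-embedded : ∀ (f : Arc → Bool) → (∀ {e e′} → SameEdge e e′ → f e ≡ f e′) →
      sum (λ j → f (reduced (embed j))) ≡ sum (λ j → f (lookup as j))
    sum-embedded f f-cong = sum-cong-≗ (λ j → f-cong (embed-sameEdge j))

    parity-if-length≡ : n ≡ length as → parity (negCount n σ) ≡ parity (negatives as)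
    parity-if-length≡ eq = begin
      parity (negCount n σ)
        ≡⟨ sym parity-reduced ⟩
      sum (λ i → isNegative (sign (reduced i)))
        ≡⟨ sum-reindex (sym eq) embed embed-injective _ ⟩
      sum (λ j → isNegative (sign (reduced (embed j))))
        ≡⟨ sum-embedded (isNegative ∘ sign) (cong isNegative ∘ proj₁) ⟩
      sum (λ j → isNegative (sign (lookup as j)))
        ≡⟨ sym (parity-negatives as) ⟩
      parity (negatives as) ∎
      where open ≡-Reasoning

    -- The one cycle edge outside the embedded tour has even degree at every vertex, so it is a loop.
    parity-if-length≡suc : ∀ {x} → Walk x x as → n ≡ suc (length as) →
      parity (negCount n σ) ≡ not (parity (negatives as))
    parity-if-length≡suc {x} w eq = begin
      parity (negCount n σ)
        ≡⟨ sym parity-reduced ⟩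
      sum (λ i → isNegative (sign (reduced i)))
        ≡⟨ sum-reindex-missing eq embed embed-injective y missed _ ⟩
      isNegative (sign (reduced y)) xor sum (λ j → isNegative (sign (reduced (embed j))))
        ≡⟨ cong₂ _xor_ (cong isNegative y-negative) (sum-embedded (isNegative ∘ sign) (cong isNegative ∘ proj₁)) ⟩
      not (sum (λ j → isNegative (sign (lookup as j))))
        ≡⟨ cong not (sym (parity-negatives as)) ⟩
      not (parity (negatives as)) ∎
      where
      open ≡-Reasoning
      y = proj₁ (injective-suc⇒missed eq embed embed-injective)
      missed = proj₂ (injective-suc⇒missed eq embed embed-injective)
      y-degree : ∀ v → degree v (reduced y) ≡ false
      y-degree v = begin
        degree v (reduced y)
          ≡⟨ sym (xor-identityʳ _) ⟩
        degree v (reduced y) xor false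
          ≡⟨ cong (degree v (reduced y) xor_) (sym (trans (walk-degree v w) (xor-same (x ≡ᵇ v)))) ⟩
        degree v (reduced y) xor sum (λ j → degree v (lookup as j))
          ≡⟨ cong (degree v (reduced y) xor_) (sym (sum-embedded (degree v) (sameEdge-degree v))) ⟩
        degree v (reduced y) xor sum (λ j → degree v (reduced (embed j)))
          ≡⟨ sym (sum-reindex-missing eq embed embed-injective y missed (λ i → degree v (reduced i))) ⟩
        sum (λ i → degree v (reduced i))
          ≡⟨ sum-around-cycle (λ i → ∣ φ i ∣ ≡ᵇ v) ⟩
        false ∎
      y-negative : sign (reduced y) ≡ neg
      y-negative = reduced-loop⇒negative y (degree-false⇒loop (reduced y) (y-degree _))

complete⇒edgesK≤ : ∀ {n} (σ : Signature (Cycle n)) k → 2 ≤ k → HasCompleteColouring (Cycle n) σ k →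
  edgesK k ≤ n
complete⇒edgesK≤ {n} σ k 2≤k (S , φ , complete) = subst (_≤ n) length≡ length≤n
  where
  open SplitTour (splitTour k 2≤k)
  open CompleteColouring {k = k} σ S φ complete
  open Embedding (before ++ after) arcs distinct

complete⇒sameBalance : ∀ {n} (σ : Signature (Cycle n)) k → 2 ≤ k → HasCompleteColouring (Cycle n) σ k →
  n ≡ edgesK k → SameBalance (negEdgesK k) (negCount n σ)
complete⇒sameBalance {n} σ k 2≤k (S , φ , complete) n≡m =
  parity≡⇒sameBalance {negEdgesK k} {negCount n σ}
    (sym (trans (parity-if-length≡ (trans n≡m (sym length≡))) (cong parity negatives≡)))
  where
  open SplitTour (splitTour k 2≤k)
  open CompleteColouring {k = k} σ S φ complete
  open Embedding (before ++ after) arcs distinct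

complete⇒differentBalance : ∀ {n} (σ : Signature (Cycle n)) k → 2 ≤ k → HasCompleteColouring (Cycle n) σ k →
  n ≡ suc (edgesK k) → ¬ SameBalance (negEdgesK k) (negCount n σ)
complete⇒differentBalance {n} σ k 2≤k (S , φ , complete) n≡m+1 sb = not-¬ refl (begin
  parity (negEdgesK k)
    ≡⟨ sameBalance⇒parity≡ {negEdgesK k} {negCount n σ} sb ⟩
  parity (negCount n σ)
    ≡⟨ parity-if-length≡suc (walk-++ walk-before walk-after) (trans n≡m+1 (cong suc (sym length≡))) ⟩
  not (parity (negatives (before ++ after)))
    ≡⟨ cong (not ∘ parity) negatives≡ ⟩
  not (parity (negEdgesK k)) ∎)
  where
  open ≡-Reasoning
  open SplitTour (splitTour k 2≤k)
  open CompleteColouring {k = k} σ S φ complete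
  open Embedding (before ++ after) arcs distinct

-- Complete colourings from padded tours

any-splice : ∀ {P : Arc → Set} xs ys zs → Any P (xs ++ zs) → Any P (xs ++ ys ++ zs)
any-splice xs ys zs p with AnyP.++⁻ xs p
... | inj₁ q = AnyP.++⁺ˡ q
... | inj₂ q = AnyP.++⁺ʳ xs (AnyP.++⁺ʳ ys q)

covers-splice : ∀ {k} xs ys zs → Covers k (xs ++ zs) → Covers k (xs ++ ys ++ zs)
covers-splice xs ys zs cov = record
  { covers-vertex = λ a ka → any-splice xs ys zs (covers-vertex cov a ka)
  ; covers-pair   = λ a b ka kb a<b s → any-splice xs ys zs (covers-pair cov a b ka kb a<b s)
  ; covers-loop   = λ a ka a≢0 → any-splice xs ys zs (covers-loop cov a ka a≢0)
  }

count-splice : (f : List Arc → ℕ) → (∀ as bs → f (as ++ bs) ≡ f as + f bs) →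
  ∀ xs ys zs → f (xs ++ ys ++ zs) ≡ f (xs ++ zs) + f ys
count-splice f f-++ xs ys zs = begin
  f (xs ++ ys ++ zs)       ≡⟨ trans (f-++ xs _) (cong (f xs +_) (f-++ ys zs)) ⟩
  f xs + (f ys + f zs)     ≡⟨ arith (f xs) (f ys) (f zs) ⟩
  (f xs + f zs) + f ys     ≡⟨ cong (_+ f ys) (sym (f-++ xs zs)) ⟩
  f (xs ++ zs) + f ys      ∎
  where
  open ≡-Reasoning
  arith : ∀ a b c → a + (b + c) ≡ (a + c) + b
  arith = solve-∀

spliced⇒complete : ∀ {n} (σ : Signature (Cycle n)) k → 2 ≤ k → (xs : List Arc) → Walk 1 1 xs →
  All (ArcOver (KVert k)) xs → n ≡ edgesK k + length xs →
  SameBalance (negEdgesK k + negatives xs) (negCount n σ) → HasCompleteColouring (Cycle n) σ k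
spliced⇒complete {n} σ k 2≤k xs walk-xs arcs-xs n≡ sb =
  closedWalk⇒complete n (before ++ xs ++ after) σ length-spliced
    (walk-++ walk-before (walk-++ walk-xs walk-after))
    (AllP.++⁺ (proj₁ (AllP.++⁻ before arcs)) (AllP.++⁺ arcs-xs (proj₂ (AllP.++⁻ before arcs))))
    (covers-splice before xs after covers)
    (trans (sym (sameBalance⇒parity≡ {negEdgesK k + negatives xs} {negCount n σ} sb))
           (cong parity (sym negatives-spliced)))
  where
  open SplitTour (splitTour k 2≤k)
  length-spliced : n ≡ length (before ++ xs ++ after)
  length-spliced = trans n≡ (sym (trans (count-splice length (λ as bs → length-++ as) before xs after)
                                       (cong (_+ length xs) length≡)))
  negatives-spliced : negatives (before ++ xs ++ after) ≡ negEdgesK k + negatives xs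
  negatives-spliced = trans (count-splice negatives negatives-++ before xs after) (cong (_+ negatives xs) negatives≡)

loopsAtOne : ℕ → List Arc
loopsAtOne d = replicate d (arc 1 1 neg)

walk-loopsAtOne : ∀ d → Walk 1 1 (loopsAtOne d)
walk-loopsAtOne zero    = done
walk-loopsAtOne (suc d) = step (walk-loopsAtOne d)

arcs-loopsAtOne : ∀ k d → KVert k 1 → All (ArcOver (KVert k)) (loopsAtOne d)
arcs-loopsAtOne k zero    _  = []
arcs-loopsAtOne k (suc d) k1 = arcOver k1 k1 (λ _ → (λ ()) , refl) ∷ arcs-loopsAtOne k d k1

negatives-loopsAtOne : ∀ d → negatives (loopsAtOne d) ≡ d
negatives-loopsAtOne zero    = refl
negatives-loopsAtOne (suc d) = cong suc (negatives-loopsAtOne d)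

complete-with-loops : ∀ {n} (σ : Signature (Cycle n)) k → 2 ≤ k → ∀ d → n ≡ edgesK k + d →
  SameBalance (negEdgesK k + d) (negCount n σ) → HasCompleteColouring (Cycle n) σ k
complete-with-loops {n} σ k 2≤k d n≡ sb =
  spliced⇒complete σ k 2≤k (loopsAtOne d) (walk-loopsAtOne d) (arcs-loopsAtOne k d (one∈K k 2≤k))
    (trans n≡ (cong (edgesK k +_) (sym (length-replicate d))))
    (subst (λ x → SameBalance (negEdgesK k + x) (negCount n σ)) (sym (negatives-loopsAtOne d)) sb)

vertexOtherThanOne : ∀ k → 3 ≤ k → ∃[ b ] KVert k b × b ≢ 1
vertexOtherThanOne k 3≤k with half k
vertexOtherThanOne .(suc (suc p) * 2) _ | even (suc (suc p)) =
  2 , between⇒kVert-even (suc (suc p)) (s≤s z≤n , s≤s (s≤s z≤n)) , λ ()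
vertexOtherThanOne .(suc (suc p * 2)) _ | odd (suc p) = 0 , between⇒kVert-odd (suc p) (z≤n , z≤n) , λ ()
vertexOtherThanOne .(0 * 2)       () | even zero
vertexOtherThanOne .(1 * 2)       (s≤s (s≤s ())) | even (suc zero)
vertexOtherThanOne .(suc (0 * 2)) (s≤s ()) | odd zero

-- With two spare edges either parity can be reached: two more negative loops at 1,
-- or a positive and a negative edge between 1 and another vertex.
complete-with-slack : ∀ {n} (σ : Signature (Cycle n)) k → 3 ≤ k → edgesK k + 2 ≤ n →
  HasCompleteColouring (Cycle n) σ k
complete-with-slack {n} σ k 3≤k m+2≤n with m≤n⇒∃[o]m+o≡n m+2≤n
... | d , refl with (negEdgesK k + d) % 2 ≟ negCount n σ % 2
...   | yes sb = complete-with-loops σ k 2≤k (2 + d) (+-assoc (edgesK k) 2 d)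
  (subst (λ x → SameBalance x (negCount n σ)) (sym (trans (+-suc m⁻ (suc d)) (cong suc (+-suc m⁻ d)))) sb)
  where
  m⁻ = negEdgesK k
  2≤k = ≤-trans (n≤1+n 2) 3≤k
...   | no ¬sb = spliced⇒complete σ k 2≤k detour (step (step (walk-loopsAtOne d)))
  (arcOver-nonLoop (b≢1 ∘ sym) k1 kb ∷ arcOver-nonLoop b≢1 kb k1 ∷ arcs-loopsAtOne k d k1)
  (trans (+-assoc (edgesK k) 2 d) (cong (λ x → edgesK k + suc (suc x)) (sym (length-replicate d))))
  (subst (λ x → SameBalance x (negCount n σ)) (sym (trans (cong (m⁻ +_) (cong suc (negatives-loopsAtOne d))) (+-suc m⁻ d)))
    (¬sameBalance⇒sameBalance-suc {m⁻ + d} {negCount n σ} ¬sb))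
  where
  m⁻ = negEdgesK k
  2≤k = ≤-trans (n≤1+n 2) 3≤k
  k1 = one∈K k 2≤k
  b = proj₁ (vertexOtherThanOne k 3≤k)
  kb = proj₁ (proj₂ (vertexOtherThanOne k 3≤k))
  b≢1 = proj₂ (proj₂ (vertexOtherThanOne k 3≤k))
  detour = arc 1 b pos ∷ arc b 1 neg ∷ loopsAtOne d

extend-above : ∀ {P : ℕ → Set} t → ¬ P (suc t) → (∀ j → suc t < j → ¬ P j) → ∀ j → t < j → ¬ P j
extend-above t ¬P above j t<j with m≤n⇒m<n∨m≡n t<j
... | inj₂ refl = ¬P
... | inj₁ lt   = above j lt

k₀≥3 : ∀ {n k₀} → 3 ≤ n → IsK0 n k₀ → 3 ≤ k₀
k₀≥3 3≤n (_ , _ , maximal) = maximal 3 (s≤s z≤n) 3≤n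

noComplete-above : ∀ {n k₀} → 3 ≤ n → (σ : Signature (Cycle n)) → IsK0 n k₀ →
  ∀ j → k₀ < j → ¬ HasCompleteColouring (Cycle n) σ j
noComplete-above 3≤n σ isK0@(_ , _ , maximal) j k₀<j has =
  <⇒≱ k₀<j (maximal j (≤-trans (s≤s z≤n) k₀<j) (complete⇒edgesK≤ σ j 2≤j has))
  where 2≤j = ≤-trans (n≤1+n 2) (≤-trans (k₀≥3 3≤n isK0) (<⇒≤ k₀<j))

achromatic-k₀ : ∀ {n k₀} → 3 ≤ n → (σ : Signature (Cycle n)) → IsK0 n k₀ →
  edgesK k₀ + 2 ≤ n
    ⊎ (n ≡ edgesK k₀ + 1 × ¬ SameBalance (negEdgesK k₀) (negCount n σ))
    ⊎ (n ≡ edgesK k₀ × SameBalance (negEdgesK k₀) (negCount n σ)) →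
  AchromaticNumberIs (Cycle n) σ k₀
achromatic-k₀ {n} {k₀} 3≤n σ isK0 cases = proj₁ isK0 , complete cases , noComplete-above 3≤n σ isK0
  where
  3≤k₀ = k₀≥3 3≤n isK0
  2≤k₀ = ≤-trans (n≤1+n 2) 3≤k₀
  complete : _ → HasCompleteColouring (Cycle n) σ k₀
  complete (inj₁ slack) = complete-with-slack σ k₀ 3≤k₀ slack
  complete (inj₂ (inj₁ (n≡ , ¬sb))) = complete-with-loops σ k₀ 2≤k₀ 1 n≡
    (subst (λ m → SameBalance m (negCount n σ)) (+-comm 1 (negEdgesK k₀))
      (¬sameBalance⇒sameBalance-suc {negEdgesK k₀} {negCount n σ} ¬sb))
  complete (inj₂ (inj₂ (n≡ , sb))) = complete-with-loops σ k₀ 2≤k₀ 0 (trans n≡ (sym (+-identityʳ _)))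
    (subst (λ m → SameBalance m (negCount n σ)) (sym (+-identityʳ (negEdgesK k₀))) sb)

achromatic-k₀∸1-balanced : ∀ {n} → 3 ≤ n → (σ : Signature (Cycle n)) → ∀ k₀ → IsK0 n k₀ →
  n ≡ edgesK k₀ + 1 → SameBalance (negEdgesK k₀) (negCount n σ) → AchromaticNumberIs (Cycle n) σ (k₀ ∸ 1)
achromatic-k₀∸1-balanced 3≤n σ zero isK0 _ _ with () ← k₀≥3 3≤n isK0
achromatic-k₀∸1-balanced 3≤n σ (suc t) isK0@(_ , _ , maximal) n≡ sb with m≤n⇒m<n∨m≡n (k₀≥3 3≤n isK0)
... | inj₂ refl = ⊥-elim (1+n≰n (maximal 4 (s≤s z≤n) (≤-reflexive (sym n≡))))
... | inj₁ 3<k₀ = ≤-trans (s≤s z≤n) 3≤t , complete-with-slack σ t 3≤t slack ,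
  extend-above t
    (λ has → complete⇒differentBalance σ (suc t) (≤-trans (s≤s (s≤s z≤n)) 3<k₀) has (trans n≡ (+-comm _ 1)) sb)
    (noComplete-above 3≤n σ isK0)
  where
  3≤t = ≤-pred 3<k₀
  slack : edgesK t + 2 ≤ _
  slack = ≤-trans (≤-reflexive (+-comm (edgesK t) 2))
    (≤-trans (s≤s (edgesK-< t (≤-trans (s≤s z≤n) 3≤t))) (≤-reflexive (trans (+-comm 1 _) (sym n≡))))

achromatic-k₀∸1-odd : ∀ {n} → 3 ≤ n → (σ : Signature (Cycle n)) → ∀ k₀ → IsK0 n k₀ →
  n ≡ edgesK k₀ → k₀ % 2 ≡ 1 → ¬ SameBalance (negEdgesK k₀) (negCount n σ) →
  AchromaticNumberIs (Cycle n) σ (k₀ ∸ 1)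
achromatic-k₀∸1-odd 3≤n σ k₀ isK0 n≡ odd′ ¬sb with half k₀
... | even p with () ← trans (sym (%2-even p)) odd′
achromatic-k₀∸1-odd 3≤n σ .(suc (0 * 2)) isK0 _ _ _ | odd zero with s≤s () ← k₀≥3 3≤n isK0
achromatic-k₀∸1-odd {n} 3≤n σ .(suc (1 * 2)) isK0 n≡ _ ¬sb | odd (suc zero) =
  s≤s z≤n , complete-with-loops σ 2 ≤-refl 2 n≡ (¬sameBalance⇒sameBalance-suc {2} {negCount n σ} ¬sb) ,
  extend-above 2 (λ has → ¬sb (complete⇒sameBalance σ 3 (n≤1+n 2) has n≡)) (noComplete-above 3≤n σ isK0)
achromatic-k₀∸1-odd 3≤n σ .(suc (p * 2)) isK0 n≡ _ ¬sb | odd p@(suc (suc _)) =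
  s≤s z≤n , complete-with-slack σ (p * 2) (s≤s (s≤s (s≤s z≤n))) slack ,
  extend-above (p * 2) (λ has → ¬sb (complete⇒sameBalance σ (suc (p * 2)) (s≤s (s≤s z≤n)) has n≡))
    (noComplete-above 3≤n σ isK0)
  where
  slack : edgesK (p * 2) + 2 ≤ _
  slack = ≤-trans (+-monoʳ-≤ (edgesK (p * 2)) (s≤s (s≤s z≤n)))
    (≤-reflexive (sym (trans n≡ (edgesK-odd-step p))))

complete-two-below-even : ∀ {n} (σ : Signature (Cycle n)) p → n ≡ edgesK (suc (suc p) * 2) →
  ¬ SameBalance (negEdgesK (suc (suc p) * 2)) (negCount n σ) → HasCompleteColouring (Cycle n) σ (suc p * 2)
complete-two-below-even {n} σ zero    n≡ ¬sb =
  complete-with-loops σ 2 ≤-refl 3 n≡ (¬sameBalance⇒sameBalance-suc {3} {negCount n σ} ¬sb)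
complete-two-below-even {n} σ (suc p) n≡ _  = complete-with-slack σ t (s≤s (s≤s (s≤s z≤n))) slack
  where
  t = suc (suc p) * 2
  slack : edgesK t + 2 ≤ n
  slack = ≤-trans (+-monoʳ-≤ (edgesK t) (s≤s (s≤s z≤n)))
    (≤-reflexive (trans (+-suc (edgesK t) t)
      (sym (trans n≡ (trans (edgesK-even-step (suc (suc p))) (cong suc (edgesK-odd-step (suc (suc p)))))))))

achromatic-k₀∸2 : ∀ {n} → 3 ≤ n → (σ : Signature (Cycle n)) → ∀ k₀ → IsK0 n k₀ →
  n ≡ edgesK k₀ → ¬ SameBalance (negEdgesK k₀) (negCount n σ) → k₀ % 2 ≡ 0 →
  AchromaticNumberIs (Cycle n) σ (k₀ ∸ 2)
achromatic-k₀∸2 3≤n σ k₀ isK0 n≡ ¬sb even′ with half k₀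
... | odd p with () ← trans (sym (%2-odd p)) even′
achromatic-k₀∸2 3≤n σ .(0 * 2) isK0 _ _ _ | even zero with () ← k₀≥3 3≤n isK0
achromatic-k₀∸2 3≤n σ .(1 * 2) isK0 _ _ _ | even (suc zero) with s≤s (s≤s ()) ← k₀≥3 3≤n isK0
achromatic-k₀∸2 {n} 3≤n σ .(suc (suc p) * 2) isK0 n≡ ¬sb _ | even (suc (suc p)) =
  s≤s z≤n , complete-two-below-even σ p n≡ ¬sb ,
  extend-above t (λ has → complete⇒differentBalance σ (suc t) (s≤s (s≤s z≤n)) has
                            (trans n≡ (edgesK-even-step (suc p))) balanced-below)
    (extend-above (suc t) (λ has → ¬sb (complete⇒sameBalance σ (suc (suc t)) (s≤s (s≤s z≤n)) has n≡))
      (noComplete-above 3≤n σ isK0))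
  where
  t = suc p * 2
  balanced-below : SameBalance (negEdgesK (suc t)) (negCount n σ)
  balanced-below = ¬sameBalance⇒sameBalance-suc {suc (negEdgesK (suc t))} {negCount n σ}
    (subst (λ m → ¬ SameBalance m (negCount n σ)) (negEdgesK-even-step (suc p)) ¬sb)

%2-cases : ∀ k → k % 2 ≡ 0 ⊎ k % 2 ≡ 1
%2-cases k with half k
... | even p = inj₁ (%2-even p)
... | odd  p = inj₂ (%2-odd p)

remaining-case : ∀ {n k₀} (σ : Signature (Cycle n)) → IsK0 n k₀ →
  ¬ (edgesK k₀ + 2 ≤ n
      ⊎ (n ≡ edgesK k₀ + 1 × ¬ SameBalance (negEdgesK k₀) (negCount n σ))
      ⊎ (n ≡ edgesK k₀ × SameBalance (negEdgesK k₀) (negCount n σ))) →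
  ¬ (n ≡ edgesK k₀ + 1 × SameBalance (negEdgesK k₀) (negCount n σ)
      ⊎ (n ≡ edgesK k₀ × k₀ % 2 ≡ 1 × ¬ SameBalance (negEdgesK k₀) (negCount n σ))) →
  n ≡ edgesK k₀ × ¬ SameBalance (negEdgesK k₀) (negCount n σ) × k₀ % 2 ≡ 0
remaining-case {n} {k₀} σ (_ , m≤n , _) ¬i ¬ii = n≡m , ¬sb , even′
  where
  n≡m : n ≡ edgesK k₀
  n≡m with m≤n⇒m<n∨m≡n m≤n
  ... | inj₂ m≡n = sym m≡n
  ... | inj₁ m<n with m≤n⇒m<n∨m≡n m<n
  ...   | inj₁ m+1<n = ⊥-elim (¬i (inj₁ (≤-trans (≤-reflexive (+-comm (edgesK k₀) 2)) m+1<n)))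
  ...   | inj₂ m+1≡n with negEdgesK k₀ % 2 ≟ negCount n σ % 2
  ...     | yes sb = ⊥-elim (¬ii (inj₁ (trans (sym m+1≡n) (+-comm 1 _) , sb)))
  ...     | no ¬sb = ⊥-elim (¬i (inj₂ (inj₁ (trans (sym m+1≡n) (+-comm 1 _) , ¬sb))))
  ¬sb : ¬ SameBalance (negEdgesK k₀) (negCount n σ)
  ¬sb sb = ¬i (inj₂ (inj₂ (n≡m , sb)))
  even′ : k₀ % 2 ≡ 0
  even′ with %2-cases k₀
  ... | inj₁ even′ = even′
  ... | inj₂ odd′ = ⊥-elim (¬ii (inj₂ (n≡m , odd′ , ¬sb)))

theorem2p15 : (n : ℕ) → 3 ≤ n → (σ : Signature (Cycle n)) → (k₀ : ℕ) → IsK0 n k₀ →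
    ((edgesK k₀ + 2 ≤ n
        ⊎ (n ≡ edgesK k₀ + 1 × ¬ SameBalance (negEdgesK k₀) (negCount n σ))
        ⊎ (n ≡ edgesK k₀ × SameBalance (negEdgesK k₀) (negCount n σ)))
       → AchromaticNumberIs (Cycle n) σ k₀)
    × ((n ≡ edgesK k₀ + 1 × SameBalance (negEdgesK k₀) (negCount n σ)
        ⊎ (n ≡ edgesK k₀ × k₀ % 2 ≡ 1 × ¬ SameBalance (negEdgesK k₀) (negCount n σ)))
       → AchromaticNumberIs (Cycle n) σ (k₀ ∸ 1))
    × (¬ (edgesK k₀ + 2 ≤ n
          ⊎ (n ≡ edgesK k₀ + 1 × ¬ SameBalance (negEdgesK k₀) (negCount n σ))
          ⊎ (n ≡ edgesK k₀ × SameBalance (negEdgesK k₀) (negCount n σ)))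
       → ¬ (n ≡ edgesK k₀ + 1 × SameBalance (negEdgesK k₀) (negCount n σ)
          ⊎ (n ≡ edgesK k₀ × k₀ % 2 ≡ 1 × ¬ SameBalance (negEdgesK k₀) (negCount n σ)))
       → AchromaticNumberIs (Cycle n) σ (k₀ ∸ 2))
theorem2p15 n 3≤n σ k₀ isK0 =
  achromatic-k₀ 3≤n σ isK0 ,
  (λ { (inj₁ (n≡ , sb))         → achromatic-k₀∸1-balanced 3≤n σ k₀ isK0 n≡ sb
     ; (inj₂ (n≡ , odd′ , ¬sb)) → achromatic-k₀∸1-odd 3≤n σ k₀ isK0 n≡ odd′ ¬sb }) ,
  λ ¬i ¬ii → let n≡ , ¬sb , even′ = remaining-case σ isK0 ¬i ¬ii
             in achromatic-k₀∸2 3≤n σ k₀ isK0 n≡ ¬sb even′
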